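{- Let $m \geq 6$ and $n \ge 3$. Then $\gamma_{r2}(C_{m} \Box C_n) \le \left\lceil \frac{n}{3}\right\rceil (m + \gamma)$, where $\gamma = 0$ if $m \equiv 0 \pmod 6$, $\gamma=1$ if $m \equiv 5 \pmod 6$, and $\gamma=2$ if $m \equiv 1,2,3,4 \pmod 6$.
   Context: A 2-rainbow dominating function (2RDF) of a graph $G$ assigns to each vertex a subset of $\{1,2\}$ so that every vertex $v$ with $f(v)=\emptyset$ satisfies $\bigcup_{u\in N(v)} f(u)=\{1,2\}$; its weight is $\sum_v |f(v)|$ and $\gamma_{r2}(G)$ is the minimum weight of a 2RDF of $G$. $C_m \Box C_n$ is the Cartesian product of the cycles $C_m$ and $C_n$. -}

module Defs where

open import Data.Nat using (ℕ; zero; suc; _+_; _≤_)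
open import Data.Fin using (Fin; toℕ)
open import Data.Bool using (Bool; true; false; T)
open import Data.Product using (_×_; _,_; ∃; ∃-syntax; Σ)
open import Data.Sum using (_⊎_)
open import Data.List using (List; map; allFin; cartesianProduct)
open import Data.Nat.ListAction using (sum)
open import Relation.Binary.PropositionalEquality using (_≡_)

record Graph : Set₁ where
  field
    V        : Set
    vertices : List V          -- enumeration of all vertices (each once)
    Adj      : V → V → Set

open Graph public

CycleAdj : (n : ℕ) → Fin n → Fin n → Set
CycleAdj n i j =
  (toℕ i + 1 ≡ toℕ j) ⊎ (toℕ j + 1 ≡ toℕ i)
  ⊎ ((toℕ i + 1 ≡ n) × (toℕ j ≡ 0))
  ⊎ ((toℕ j + 1 ≡ n) × (toℕ i ≡ 0))

Cycle : ℕ → Graph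
Cycle n = record { V = Fin n ; vertices = allFin n ; Adj = CycleAdj n }

_□_ : Graph → Graph → Graph
G □ H = record
  { V = V G × V H
  ; vertices = cartesianProduct (vertices G) (vertices H)
  ; Adj = λ { (g , h) (g' , h') →
        (Adj G g g' × h ≡ h') ⊎ (g ≡ g' × Adj H h h') } }

-- 2-rainbow domination.
-- A subset of {1,2} is a pair of Booleans (contains 1?, contains 2?).

Sub2 : Set
Sub2 = Bool × Bool

∣_∣₂ : Sub2 → ℕ
∣ (a , b) ∣₂ = b2n a + b2n b
  where
  b2n : Bool → ℕ
  b2n true  = 1
  b2n false = 0

Is2RDF : (G : Graph) → (V G → Sub2) → Set
Is2RDF G f = ∀ v → f v ≡ (false , false) →
  (∃[ u ] (Adj G v u × T (Data.Product.proj₁ (f u))))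
  × (∃[ w ] (Adj G v w × T (Data.Product.proj₂ (f w))))

weight : (G : Graph) → (V G → Sub2) → ℕ
weight G f = sum (map (λ v → ∣ f v ∣₂) (vertices G))

-- γ_{r2}(G) ≤ k  :⇔  some 2RDF of G has weight ≤ k
-- (equivalent to the minimum weight being ≤ k).
γr2≤ : Graph → ℕ → Set
γr2≤ G k = Σ (V G → Sub2) λ f → Is2RDF G f × weight G f ≤ k

gammaCorr : ℕ → ℕ
gammaCorr m with m Data.Nat.% 6
... | 0 = 0
... | 5 = 1
... | _ = 2

ceil/3 : ℕ → ℕ
ceil/3 n = (n + 2) Data.Nat./ 3

{-# OPTIONS --safe #-}
-- Along C_m, repeat the six-column 2RDF of C_6 □ C_3 that has one label per column,
-- preceded by s = m mod 6 special columns of total weight at most s + γ. Along C_n,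
-- repeat its three rows and, when 3 ∤ n, add one or two rows that are unions of
-- pattern rows; each column then costs at most ⌈n/3⌉ times its weight in the pattern.
-- Whether a vertex is dominated depends only on the windows of three consecutive
-- columns and rows through it, and in a word with a repeated period every such
-- window already occurs when the period is repeated twice. So validity reduces to
-- a finite computation on the tori C_(s+12) □ C_(r+6).
module Submission where

open import Defs
open import Data.Bool using (Bool; true; false; T; _∧_; _∨_)
open import Data.Bool.ListAction using (any)
open import Data.Bool.Properties using (T-∧)
open import Data.Empty using (⊥-elim)
open import Data.Fin using (Fin; zero; suc; toℕ; fromℕ; fromℕ<; inject₁)
open import Data.Fin.Properties using (toℕ<n; toℕ-fromℕ; toℕ-fromℕ<; toℕ-inject₁; all?)
open import Data.List using (List; []; _∷_; _++_; map; allFin; tabulate; applyUpTo; cartesianProduct)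
open import Data.List.Properties using (map-++; map-∘; map-cong; map-tabulate)
open import Data.List.Relation.Unary.All using (All; []; _∷_; lookupAny)
open import Data.List.Relation.Unary.Any as Any using ()
open import Data.List.Relation.Unary.Any.Properties using (any⁻; map⁻)
open import Data.Nat using (ℕ; zero; suc; NonZero; _+_; _*_; _∸_; _/_; _%_; _<_; _≤_; _<?_; _≤?_; z≤n; s≤s)
open import Data.Nat.Divisibility using (divides-refl)
open import Data.Nat.DivMod
  using (_mod_; m≡m%n+[m/n]*n; m%n<n; /-congˡ; +-distrib-/-∣ʳ; m*n/n≡m; [m+kn]%n≡m%n; m≥n⇒m/n>0)
open import Data.Nat.ListAction using (sum)
open import Data.Nat.ListAction.Properties using (sum-++)
open import Data.Nat.Properties
open import Algebra.Properties.CommutativeSemigroup +-commutativeSemigroup using (x∙yz≈y∙xz; xy∙z≈xz∙y)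
open import Data.Product using (_×_; _,_; proj₁; proj₂; ∃-syntax; Σ-syntax)
open import Data.Sum using (inj₁; inj₂)
open import Data.Vec using (Vec; []; _∷_)
open import Function using (_∘_; id)
open import Function.Bundles using (Equivalence)
open import Relation.Binary.PropositionalEquality
open import Relation.Nullary using (yes; no)
open import Relation.Nullary.Decidable using (from-yes; T?)

∅ ① ② ①② : Sub2
∅  = false , false
①  = true  , false
②  = false , true
①② = true  , true

_∪_ : Sub2 → Sub2 → Sub2
(a , b) ∪ (c , d) = a ∨ c , b ∨ d

∣∪∣≤ : ∀ x y → ∣ x ∪ y ∣₂ ≤ ∣ x ∣₂ + ∣ y ∣₂
∣∪∣≤ (false , false) (c     , d)     = ≤-refl
∣∪∣≤ (true  , true)  (c     , d)     = m≤m+n 2 ∣ c , d ∣₂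
∣∪∣≤ (true  , false) (c     , false) = m≤m+n 1 ∣ c , false ∣₂
∣∪∣≤ (false , true)  (false , d)     = m≤m+n 1 ∣ false , d ∣₂
∣∪∣≤ (true  , false) (false , true)  = ≤-refl
∣∪∣≤ (true  , false) (true  , true)  = m≤n+m 2 1
∣∪∣≤ (false , true)  (true  , false) = ≤-refl
∣∪∣≤ (false , true)  (true  , true)  = m≤n+m 2 1

rainbow : Sub2 → List Sub2 → Bool
rainbow (a , b) ns = a ∨ b ∨ (any proj₁ ns ∧ any proj₂ ns)

Is2RDF-fromNeighbourhoods : (G : Graph) (f : V G → Sub2) (N : V G → List (V G)) →
  (∀ v → All (Adj G v) (N v)) → (∀ v → T (rainbow (f v) (map f (N v)))) → Is2RDF G f
Is2RDF-fromNeighbourhoods G f N adjacent rainbowAt v fv≡∅ =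
  witness proj₁ (proj₁ both) , witness proj₂ (proj₂ both)
  where
  both : T (any proj₁ (map f (N v))) × T (any proj₂ (map f (N v)))
  both = Equivalence.to T-∧ (subst (λ x → T (rainbow x (map f (N v)))) fv≡∅ (rainbowAt v))
  witness : (π : Sub2 → Bool) → T (any π (map f (N v))) → ∃[ u ] (Adj G v u × T (π (f u)))
  witness π t = let u∈N = map⁻ (any⁻ π _ t) in Any.lookup u∈N , lookupAny (adjacent v) u∈N

prev : ℕ → ℕ → ℕ
prev n zero    = n ∸ 1
prev n (suc a) = a

next : ℕ → ℕ → ℕ
next n a with suc a <? n
... | yes _ = suc a
... | no  _ = 0

next-< : ∀ {n a} → suc a < n → next n a ≡ suc a
next-< {n} {a} lt with suc a <? n
... | yes _  = refl
... | no  ≮ = ⊥-elim (≮ lt)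

next-last : ∀ {n a} → suc a ≡ n → next n a ≡ 0
next-last {n} {a} eq with suc a <? n
... | yes lt = ⊥-elim (<⇒≢ lt eq)
... | no  _  = refl

prevᶠ : ∀ {n} → Fin n → Fin n
prevᶠ {suc n} zero    = fromℕ n
prevᶠ {suc n} (suc i) = inject₁ i

nextᶠ : ∀ {n} → Fin n → Fin n
nextᶠ {suc n} i with suc (toℕ i) <? suc n
... | yes lt = fromℕ< lt
... | no  _  = zero

toℕ-prevᶠ : ∀ {n} (i : Fin n) → toℕ (prevᶠ i) ≡ prev n (toℕ i)
toℕ-prevᶠ {suc n} zero    = toℕ-fromℕ n
toℕ-prevᶠ {suc n} (suc i) = toℕ-inject₁ i

toℕ-nextᶠ : ∀ {n} (i : Fin n) → toℕ (nextᶠ i) ≡ next n (toℕ i)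
toℕ-nextᶠ {suc n} i with suc (toℕ i) <? suc n
... | yes lt = toℕ-fromℕ< lt
... | no  _  = refl

prevᶠ-adjacent : ∀ {n} (i : Fin n) → CycleAdj n i (prevᶠ i)
prevᶠ-adjacent {suc n} zero    = inj₂ (inj₂ (inj₂ (trans (cong (_+ 1) (toℕ-fromℕ n)) (+-comm n 1) , refl)))
prevᶠ-adjacent {suc n} (suc i) = inj₂ (inj₁ (trans (cong (_+ 1) (toℕ-inject₁ i)) (+-comm (toℕ i) 1)))

nextᶠ-adjacent : ∀ {n} (i : Fin n) → CycleAdj n i (nextᶠ i)
nextᶠ-adjacent {suc n} i with suc (toℕ i) <? suc n
... | yes lt = inj₁ (trans (+-comm (toℕ i) 1) (sym (toℕ-fromℕ< lt)))
... | no  ≮ = inj₂ (inj₂ (inj₁ (trans (+-comm (toℕ i) 1) (≤-antisym (toℕ<n i) (≮⇒≥ ≮)) , refl)))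

torusNeighbours : ∀ {m n} → Fin m × Fin n → List (Fin m × Fin n)
torusNeighbours (i , j) = (prevᶠ i , j) ∷ (nextᶠ i , j) ∷ (i , prevᶠ j) ∷ (i , nextᶠ j) ∷ []

torusNeighbours-adjacent : ∀ {m n} (v : Fin m × Fin n) → All (Adj (Cycle m □ Cycle n) v) (torusNeighbours v)
torusNeighbours-adjacent (i , j) =
  inj₁ (prevᶠ-adjacent i , refl) ∷ inj₁ (nextᶠ-adjacent i , refl) ∷
  inj₂ (refl , prevᶠ-adjacent j) ∷ inj₂ (refl , nextᶠ-adjacent j) ∷ []

Window : Set → Set
Window X = X × X × X

window : ∀ {X : Set} → ℕ → (ℕ → X) → ℕ → Window X
window n h a = h (prev n a) , h a , h (next n a)

splice : ∀ {X : Set} {s} → Vec X s → (ℕ → X) → ℕ → X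
splice []       g a       = g a
splice (x ∷ u)  g zero    = x
splice (x ∷ u)  g (suc a) = splice u g a

splice-+ : ∀ {X : Set} {s} (u : Vec X s) (g : ℕ → X) j → splice u g (s + j) ≡ g j
splice-+ []      g j = refl
splice-+ (x ∷ u) g j = splice-+ u g j

module Pumping {X : Set} {s : ℕ} (u : Vec X s) (g : ℕ → X) (k₂ : ℕ)
                (periodic : ∀ a → g (2 + k₂ + a) ≡ g a) where

  private
    k : ℕ
    k = 2 + k₂

    h : ℕ → X
    h = splice u g

  g-periodic : ∀ q a → g (a + q * k) ≡ g a
  g-periodic zero    a = cong g (+-identityʳ a)
  g-periodic (suc q) a = begin
    g (a + (k + q * k))  ≡⟨ cong g (x∙yz≈y∙xz a k (q * k)) ⟩
    g (k + (a + q * k))  ≡⟨ periodic (a + q * k) ⟩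
    g (a + q * k)        ≡⟨ g-periodic q a ⟩
    g a                  ∎
    where open ≡-Reasoning

  h-suc-+ : ∀ j → h (suc (s + j)) ≡ g (suc j)
  h-suc-+ j = trans (cong h (sym (+-suc s j))) (splice-+ u g (suc j))

  length-≡ : ∀ p → s + suc p * k ≡ suc (suc (s + (k₂ + p * k)))
  length-≡ p = trans (+-suc s _) (cong suc (+-suc s _))

  head<length : ∀ p {a} → a ≤ s → suc a < s + suc p * k
  head<length p {a} a≤s = subst (suc a <_) (sym (length-≡ p)) (s≤s (s≤s (≤-trans a≤s (m≤m+n s _))))

  interior<length : ∀ p {x} → x < k → suc (suc (s + x)) < s + suc (suc p) * k
  interior<length p {x} x<k = subst (suc (suc (s + x)) <_) (sym (length-≡ (suc p)))
    (s≤s (s≤s (subst (_≤ s + (k₂ + suc p * k)) (+-suc s x)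
      (+-monoʳ-≤ s (≤-trans x<k (≤-trans (m≤m+n k (p * k)) (m≤n+m _ k₂)))))))

  h-last : ∀ p → h (s + suc p * k ∸ 1) ≡ g (suc k₂)
  h-last p = trans (cong (λ n → h (n ∸ 1)) (length-≡ p))
                   (trans (h-suc-+ (k₂ + p * k)) (g-periodic p (suc k₂)))

  next-head : ∀ p q {a} → a ≤ s → next (s + suc p * k) a ≡ next (s + suc q * k) a
  next-head p q a≤s = trans (next-< (head<length p a≤s)) (sym (next-< (head<length q a≤s)))

  window-head : ∀ p q {a} → a ≤ s → window (s + suc p * k) h a ≡ window (s + suc q * k) h a
  window-head p q {zero}  a≤s = cong₂ _,_ (trans (h-last p) (sym (h-last q)))
                                          (cong (λ b → h 0 , h b) (next-head p q a≤s))
  window-head p q {suc a} a≤s = cong (λ b → h a , h (suc a) , h b) (next-head p q a≤s)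

  gWindow : ℕ → Window X
  gWindow j = g j , g (suc j) , g (suc (suc j))

  gWindow-periodic : ∀ q j → gWindow (j + q * k) ≡ gWindow j
  gWindow-periodic q j = cong₂ _,_ (g-periodic q j)
    (cong₂ _,_ (g-periodic q (suc j)) (g-periodic q (suc (suc j))))

  gWindow-% : ∀ j → gWindow j ≡ gWindow (j % k)
  gWindow-% j = trans (cong gWindow (m≡m%n+[m/n]*n j k)) (gWindow-periodic (j / k) (j % k))

  window-interior : ∀ p {j} → suc (suc (s + j)) < s + suc p * k →
                    window (s + suc p * k) h (suc (s + j)) ≡ gWindow j
  window-interior p {j} inner = cong₂ _,_ (splice-+ u g j) (cong₂ _,_ (h-suc-+ j)
    (trans (cong h (next-< inner)) (trans (cong (h ∘ suc) (sym (+-suc s j))) (h-suc-+ (suc j)))))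

  window-last : ∀ p → window (s + suc p * k) h (suc (s + (k₂ + p * k))) ≡ (g k₂ , g (suc k₂) , h 0)
  window-last p = cong₂ _,_ (trans (splice-+ u g (k₂ + p * k)) (g-periodic p k₂))
    (cong₂ _,_ (trans (h-suc-+ (k₂ + p * k)) (g-periodic p (suc k₂)))
               (cong h (next-last (sym (length-≡ p)))))

  -- a′ is a itself next to u, the last position for the last one, and 1 + s + (j mod k)
  -- for a = 1 + s + j in between.
  pump : ∀ p {a} → a < s + suc p * k →
         ∃[ a′ ] a′ < s + 2 * k × window (s + suc p * k) h a ≡ window (s + 2 * k) h a′
  pump p {a} a<len with a ≤? s
  ... | yes a≤s = a , <⇒≤ (head<length 1 a≤s) , window-head p 1 a≤s
  ... | no  a≰s with m≤n⇒∃[o]m+o≡n (≰⇒> a≰s)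
  ...   | j , refl with m≤n⇒m<n∨m≡n a<len
  ...     | inj₁ inner = suc (s + j % k) , <⇒≤ inner′ ,
            trans (window-interior p inner) (trans (gWindow-% j) (sym (window-interior 1 inner′)))
    where inner′ = interior<length 0 (m%n<n j k)
  ...     | inj₂ last with +-cancelˡ-≡ s j (k₂ + p * k)
                             (suc-injective (suc-injective (trans last (length-≡ p))))
  ...       | refl = suc (s + (k₂ + 1 * k)) , ≤-reflexive (sym (length-≡ 1)) ,
                     trans (window-last p) (sym (window-last 1))

  pumpᶠ : ∀ p (i : Fin (s + suc p * k)) →
          Σ[ i′ ∈ Fin (s + 2 * k) ] window (s + suc p * k) h (toℕ i) ≡ window (s + 2 * k) h (toℕ i′)
  pumpᶠ p i with pump p (toℕ<n i)
  ... | a′ , a′< , eq = fromℕ< a′< , trans eq (cong (window _ h) (sym (toℕ-fromℕ< a′<)))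

sum-cartesianProduct : ∀ {A B : Set} (f : A × B → ℕ) xs ys →
  sum (map f (cartesianProduct xs ys)) ≡ sum (map (λ x → sum (map (λ y → f (x , y)) ys)) xs)
sum-cartesianProduct f []       ys = refl
sum-cartesianProduct f (x ∷ xs) ys = begin
  sum (map f (map (x ,_) ys ++ cartesianProduct xs ys))
    ≡⟨ cong sum (map-++ f (map (x ,_) ys) (cartesianProduct xs ys)) ⟩
  sum (map f (map (x ,_) ys) ++ map f (cartesianProduct xs ys))
    ≡⟨ sum-++ (map f (map (x ,_) ys)) _ ⟩
  sum (map f (map (x ,_) ys)) + sum (map f (cartesianProduct xs ys))
    ≡⟨ cong₂ _+_ (cong sum (sym (map-∘ ys))) (sum-cartesianProduct f xs ys) ⟩
  sum (map (λ y → f (x , y)) ys) + sum (map (λ x → sum (map (λ y → f (x , y)) ys)) xs) ∎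
  where open ≡-Reasoning

tabulate-toℕ : ∀ {A : Set} n (f : ℕ → A) → tabulate {n = n} (f ∘ toℕ) ≡ applyUpTo f n
tabulate-toℕ zero    f = refl
tabulate-toℕ (suc n) f = cong (f 0 ∷_) (tabulate-toℕ n (f ∘ suc))

sum-allFin : ∀ n (f : ℕ → ℕ) → sum (map (f ∘ toℕ) (allFin n)) ≡ sum (applyUpTo f n)
sum-allFin n f = cong sum (trans (map-tabulate id (f ∘ toℕ)) (tabulate-toℕ n f))

sum-applyUpTo-+ : ∀ (f : ℕ → ℕ) m n →
  sum (applyUpTo f (m + n)) ≡ sum (applyUpTo f m) + sum (applyUpTo (f ∘ (m +_)) n)
sum-applyUpTo-+ f zero    n = refl
sum-applyUpTo-+ f (suc m) n =
  trans (cong (f 0 +_) (sum-applyUpTo-+ (f ∘ suc) m n)) (sym (+-assoc (f 0) _ _))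

sum-applyUpTo-cong : ∀ {f g : ℕ → ℕ} → (∀ a → f a ≡ g a) → ∀ n →
  sum (applyUpTo f n) ≡ sum (applyUpTo g n)
sum-applyUpTo-cong f≗g zero    = refl
sum-applyUpTo-cong f≗g (suc n) = cong₂ _+_ (f≗g 0) (sum-applyUpTo-cong (f≗g ∘ suc) n)

sum-applyUpTo-mono-≤ : ∀ {f g : ℕ → ℕ} → (∀ a → f a ≤ g a) → ∀ n →
  sum (applyUpTo f n) ≤ sum (applyUpTo g n)
sum-applyUpTo-mono-≤ f≤g zero    = z≤n
sum-applyUpTo-mono-≤ f≤g (suc n) = +-mono-≤ (f≤g 0) (sum-applyUpTo-mono-≤ (f≤g ∘ suc) n)

sum-applyUpTo-*ˡ : ∀ c (f : ℕ → ℕ) n → sum (applyUpTo (λ a → c * f a) n) ≡ c * sum (applyUpTo f n)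
sum-applyUpTo-*ˡ c f zero    = sym (*-zeroʳ c)
sum-applyUpTo-*ˡ c f (suc n) =
  trans (cong (c * f 0 +_) (sum-applyUpTo-*ˡ c (f ∘ suc) n)) (sym (*-distribˡ-+ c (f 0) _))

sum-applyUpTo-periodic : ∀ (f : ℕ → ℕ) k → (∀ a → f (k + a) ≡ f a) → ∀ q →
  sum (applyUpTo f (q * k)) ≡ q * sum (applyUpTo f k)
sum-applyUpTo-periodic f k periodic zero    = refl
sum-applyUpTo-periodic f k periodic (suc q) = begin
  sum (applyUpTo f (k + q * k))
    ≡⟨ sum-applyUpTo-+ f k (q * k) ⟩
  sum (applyUpTo f k) + sum (applyUpTo (f ∘ (k +_)) (q * k))
    ≡⟨ cong (sum (applyUpTo f k) +_) (sum-applyUpTo-cong periodic (q * k)) ⟩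
  sum (applyUpTo f k) + sum (applyUpTo f (q * k))
    ≡⟨ cong (sum (applyUpTo f k) +_) (sum-applyUpTo-periodic f k periodic q) ⟩
  sum (applyUpTo f k) + q * sum (applyUpTo f k) ∎
  where open ≡-Reasoning

sum-splice-periodic : ∀ {X : Set} {s} (f : X → ℕ) (u : Vec X s) (g : ℕ → X) k →
  (∀ a → g (k + a) ≡ g a) → ∀ q →
  sum (applyUpTo (f ∘ splice u g) (s + q * k))
    ≡ sum (applyUpTo (f ∘ splice u g) s) + q * sum (applyUpTo (f ∘ g) k)
sum-splice-periodic {s = s} f u g k periodic q = begin
  sum (applyUpTo (f ∘ splice u g) (s + q * k))
    ≡⟨ sum-applyUpTo-+ (f ∘ splice u g) s (q * k) ⟩
  sum (applyUpTo (f ∘ splice u g) s) + sum (applyUpTo (f ∘ splice u g ∘ (s +_)) (q * k))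
    ≡⟨ cong (_ +_) (sum-applyUpTo-cong (cong f ∘ splice-+ u g) (q * k)) ⟩
  sum (applyUpTo (f ∘ splice u g) s) + sum (applyUpTo (f ∘ g) (q * k))
    ≡⟨ cong (_ +_) (sum-applyUpTo-periodic (f ∘ g) k (cong f ∘ periodic) q) ⟩
  sum (applyUpTo (f ∘ splice u g) s) + q * sum (applyUpTo (f ∘ g) k) ∎
  where open ≡-Reasoning

weight-torus : ∀ m n (F : ℕ → ℕ → Sub2) →
  weight (Cycle m □ Cycle n) (λ (i , j) → F (toℕ i) (toℕ j))
    ≡ sum (applyUpTo (λ a → sum (applyUpTo (λ b → ∣ F a b ∣₂) n)) m)
weight-torus m n F = begin
  sum (map (λ (i , j) → ∣ F (toℕ i) (toℕ j) ∣₂) (cartesianProduct (allFin m) (allFin n)))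
    ≡⟨ sum-cartesianProduct _ (allFin m) (allFin n) ⟩
  sum (map (λ i → sum (map (λ j → ∣ F (toℕ i) (toℕ j) ∣₂) (allFin n))) (allFin m))
    ≡⟨ cong sum (map-cong (λ i → sum-allFin n (λ b → ∣ F (toℕ i) b ∣₂)) (allFin m)) ⟩
  sum (map (λ i → sum (applyUpTo (λ b → ∣ F (toℕ i) b ∣₂) n)) (allFin m))
    ≡⟨ sum-allFin m (λ a → sum (applyUpTo (λ b → ∣ F a b ∣₂) n)) ⟩
  sum (applyUpTo (λ a → sum (applyUpTo (λ b → ∣ F a b ∣₂) n)) m) ∎
  where open ≡-Reasoning

Column : Set
Column = Sub2 × Sub2 × Sub2

-- A row of C_m □ C_n copies one row of a labelling of C_m □ C_3, or a union of its rows.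
data Layer : Set where
  layer₀ layer₁ layer₂ layer₀₁₂ layer₁₂ : Layer

read : Column → Layer → Sub2
read (x , y , z) layer₀   = x
read (x , y , z) layer₁   = y
read (x , y , z) layer₂   = z
read (x , y , z) layer₀₁₂ = x ∪ (y ∪ z)
read (x , y , z) layer₁₂  = y ∪ z

cycle₃ : ℕ → Layer
cycle₃ 0 = layer₀
cycle₃ 1 = layer₁
cycle₃ 2 = layer₂
cycle₃ (suc (suc (suc b))) = cycle₃ b

∥_∥ : Column → ℕ
∥ c ∥ = sum (applyUpTo (λ b → ∣ read c (cycle₃ b) ∣₂) 3)

tile : ∀ {m n} → (ℕ → Column) → (ℕ → Layer) → Fin m × Fin n → Sub2
tile c ℓ (i , j) = read (c (toℕ i)) (ℓ (toℕ j))

tileRainbow : Window Column → Window Layer → Bool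
tileRainbow (cL , c , cR) (ℓD , ℓ , ℓU) =
  rainbow (read c ℓ) (read cL ℓ ∷ read cR ℓ ∷ read c ℓD ∷ read c ℓU ∷ [])

tile-2RDF : ∀ {m n} (c : ℕ → Column) (ℓ : ℕ → Layer) →
  (∀ (i : Fin m) (j : Fin n) → T (tileRainbow (window m c (toℕ i)) (window n ℓ (toℕ j)))) →
  Is2RDF (Cycle m □ Cycle n) (tile c ℓ)
tile-2RDF {m} {n} c ℓ rainbowAt =
  Is2RDF-fromNeighbourhoods (Cycle m □ Cycle n) (tile c ℓ) torusNeighbours torusNeighbours-adjacent atVertex
  where
  atVertex : ∀ v → T (rainbow (tile c ℓ v) (map (tile c ℓ) (torusNeighbours v)))
  atVertex (i , j) rewrite toℕ-prevᶠ i | toℕ-nextᶠ i | toℕ-prevᶠ j | toℕ-nextᶠ j = rainbowAt i j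

tile-weight-≤ : ∀ m n (c : ℕ → Column) (ℓ : ℕ → Layer) K →
  (∀ col → sum (applyUpTo (λ b → ∣ read col (ℓ b) ∣₂) n) ≤ K * ∥ col ∥) →
  weight (Cycle m □ Cycle n) (tile c ℓ) ≤ K * sum (applyUpTo (∥_∥ ∘ c) m)
tile-weight-≤ m n c ℓ K columnBound = begin
  weight (Cycle m □ Cycle n) (tile c ℓ)
    ≡⟨ weight-torus m n (λ a b → read (c a) (ℓ b)) ⟩
  sum (applyUpTo (λ a → sum (applyUpTo (λ b → ∣ read (c a) (ℓ b) ∣₂) n)) m)
    ≤⟨ sum-applyUpTo-mono-≤ (columnBound ∘ c) m ⟩
  sum (applyUpTo (λ a → K * ∥ c a ∥) m)
    ≡⟨ sum-applyUpTo-*ˡ K (∥_∥ ∘ c) m ⟩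
  K * sum (applyUpTo (∥_∥ ∘ c) m) ∎
  where open ≤-Reasoning

bulk : ℕ → Column
bulk 0 = ∅ , ∅ , ①
bulk 1 = ∅ , ② , ∅
bulk 2 = ① , ∅ , ∅
bulk 3 = ∅ , ∅ , ②
bulk 4 = ∅ , ① , ∅
bulk 5 = ② , ∅ , ∅
bulk (suc (suc (suc (suc (suc (suc a)))))) = bulk a

columnPrefix : (s : Fin 6) → Vec Column (toℕ s)
columnPrefix zero = []
columnPrefix (suc zero) = (② , ∅ , ①) ∷ []
columnPrefix (suc (suc zero)) = (∅ , ∅ , ①) ∷ (② , ② , ∅) ∷ []
columnPrefix (suc (suc (suc zero))) = (∅ , ∅ , ①) ∷ (∅ , ② , ∅) ∷ (①② , ∅ , ∅) ∷ []
columnPrefix (suc (suc (suc (suc zero)))) =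
  (∅ , ∅ , ①) ∷ (∅ , ② , ∅) ∷ (① , ∅ , ∅) ∷ (② , ∅ , ①②) ∷ []
columnPrefix (suc (suc (suc (suc (suc zero))))) =
  (∅ , ∅ , ①) ∷ (∅ , ② , ∅) ∷ (① , ∅ , ∅) ∷ (∅ , ∅ , ②) ∷ (② , ① , ∅) ∷ []

layerPrefix : (r : Fin 3) → Vec Layer (toℕ r)
layerPrefix zero = []
layerPrefix (suc zero) = layer₀₁₂ ∷ []
layerPrefix (suc (suc zero)) = layer₀ ∷ layer₁₂ ∷ []

columns : Fin 6 → ℕ → Column
columns s = splice (columnPrefix s) bulk

layers : Fin 3 → ℕ → Layer
layers r = splice (layerPrefix r) cycle₃

smallTorus-rainbow : ∀ s r (i : Fin (toℕ s + 2 * 6)) (j : Fin (toℕ r + 2 * 3)) →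
  T (tileRainbow (window (toℕ s + 2 * 6) (columns s) (toℕ i)) (window (toℕ r + 2 * 3) (layers r) (toℕ j)))
smallTorus-rainbow = from-yes (all? λ s → all? λ r → all? λ i → all? λ j →
  T? (tileRainbow (window (toℕ s + 2 * 6) (columns s) (toℕ {toℕ s + 2 * 6} i))
                  (window (toℕ r + 2 * 3) (layers r) (toℕ {toℕ r + 2 * 3} j))))

construction-2RDF : ∀ s r p q →
  Is2RDF (Cycle (toℕ s + suc p * 6) □ Cycle (toℕ r + suc q * 3)) (tile (columns s) (layers r))
construction-2RDF s r p q = tile-2RDF (columns s) (layers r) λ i j →
  let i′ , i≈i′ = Pumping.pumpᶠ (columnPrefix s) bulk 4 (λ _ → refl) p i
      j′ , j≈j′ = Pumping.pumpᶠ (layerPrefix r) cycle₃ 1 (λ _ → refl) q j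
  in subst₂ (λ x y → T (tileRainbow x y)) (sym i≈i′) (sym j≈j′) (smallTorus-rainbow s r i′ j′)

∣x∣+∣y∪z∣≤∥∥ : ∀ x y z → ∣ x ∣₂ + ∣ y ∪ z ∣₂ ≤ ∥ x , y , z ∥
∣x∣+∣y∪z∣≤∥∥ x y z = begin
  ∣ x ∣₂ + ∣ y ∪ z ∣₂              ≤⟨ +-monoʳ-≤ ∣ x ∣₂ (∣∪∣≤ y z) ⟩
  ∣ x ∣₂ + (∣ y ∣₂ + ∣ z ∣₂)        ≡⟨ cong (λ t → ∣ x ∣₂ + (∣ y ∣₂ + t)) (+-identityʳ ∣ z ∣₂) ⟨
  ∥ x , y , z ∥                   ∎
  where open ≤-Reasoning

layerPrefix-weight-≤ : ∀ r col →
  sum (applyUpTo (λ b → ∣ read col (layers r b) ∣₂) (toℕ r)) ≤ ceil/3 (toℕ r) * ∥ col ∥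
layerPrefix-weight-≤ zero             col         = z≤n
layerPrefix-weight-≤ (suc zero)       (x , y , z) = begin
  ∣ x ∪ (y ∪ z) ∣₂ + 0  ≡⟨ +-identityʳ _ ⟩
  ∣ x ∪ (y ∪ z) ∣₂      ≤⟨ ∣∪∣≤ x (y ∪ z) ⟩
  ∣ x ∣₂ + ∣ y ∪ z ∣₂    ≤⟨ ∣x∣+∣y∪z∣≤∥∥ x y z ⟩
  ∥ x , y , z ∥         ≡⟨ *-identityˡ _ ⟨
  1 * ∥ x , y , z ∥     ∎
  where open ≤-Reasoning
layerPrefix-weight-≤ (suc (suc zero)) (x , y , z) = begin
  ∣ x ∣₂ + (∣ y ∪ z ∣₂ + 0)  ≡⟨ cong (∣ x ∣₂ +_) (+-identityʳ _) ⟩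
  ∣ x ∣₂ + ∣ y ∪ z ∣₂        ≤⟨ ∣x∣+∣y∪z∣≤∥∥ x y z ⟩
  ∥ x , y , z ∥             ≡⟨ *-identityˡ _ ⟨
  1 * ∥ x , y , z ∥         ∎
  where open ≤-Reasoning

layers-weight-≤ : ∀ r q col →
  sum (applyUpTo (λ b → ∣ read col (layers r b) ∣₂) (toℕ r + suc q * 3)) ≤ (ceil/3 (toℕ r) + suc q) * ∥ col ∥
layers-weight-≤ r q col = begin
  sum (applyUpTo (λ b → ∣ read col (layers r b) ∣₂) (toℕ r + suc q * 3))
    ≡⟨ sum-splice-periodic (λ ℓ → ∣ read col ℓ ∣₂) (layerPrefix r) cycle₃ 3 (λ _ → refl) (suc q) ⟩
  sum (applyUpTo (λ b → ∣ read col (layers r b) ∣₂) (toℕ r)) + suc q * ∥ col ∥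
    ≤⟨ +-monoˡ-≤ (suc q * ∥ col ∥) (layerPrefix-weight-≤ r col) ⟩
  ceil/3 (toℕ r) * ∥ col ∥ + suc q * ∥ col ∥
    ≡⟨ *-distribʳ-+ ∥ col ∥ (ceil/3 (toℕ r)) (suc q) ⟨
  (ceil/3 (toℕ r) + suc q) * ∥ col ∥ ∎
  where open ≤-Reasoning

columnPrefix-weight-≤ : ∀ s → sum (applyUpTo (∥_∥ ∘ columns s) (toℕ s)) ≤ toℕ s + gammaCorr (toℕ s)
columnPrefix-weight-≤ = from-yes (all? λ s →
  sum (applyUpTo (∥_∥ ∘ columns s) (toℕ s)) ≤? toℕ s + gammaCorr (toℕ s))

columns-weight-≤ : ∀ s p →
  sum (applyUpTo (∥_∥ ∘ columns s) (toℕ s + suc p * 6)) ≤ toℕ s + suc p * 6 + gammaCorr (toℕ s)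
columns-weight-≤ s p = begin
  sum (applyUpTo (∥_∥ ∘ columns s) (toℕ s + suc p * 6))
    ≡⟨ sum-splice-periodic ∥_∥ (columnPrefix s) bulk 6 (λ _ → refl) (suc p) ⟩
  sum (applyUpTo (∥_∥ ∘ columns s) (toℕ s)) + suc p * 6
    ≤⟨ +-monoˡ-≤ (suc p * 6) (columnPrefix-weight-≤ s) ⟩
  toℕ s + gammaCorr (toℕ s) + suc p * 6
    ≡⟨ xy∙z≈xz∙y (toℕ s) (gammaCorr (toℕ s)) (suc p * 6) ⟩
  toℕ s + suc p * 6 + gammaCorr (toℕ s) ∎
  where open ≤-Reasoning

ceil/3-+*3 : ∀ x q → ceil/3 (x + q * 3) ≡ ceil/3 x + q
ceil/3-+*3 x q = begin
  (x + q * 3 + 2) / 3      ≡⟨ /-congˡ (xy∙z≈xz∙y x (q * 3) 2) ⟩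
  (x + 2 + q * 3) / 3      ≡⟨ +-distrib-/-∣ʳ (x + 2) (divides-refl q) ⟩
  (x + 2) / 3 + q * 3 / 3  ≡⟨ cong (ceil/3 x +_) (m*n/n≡m q 3) ⟩
  ceil/3 x + q             ∎
  where open ≡-Reasoning

gammaCorr-+*6 : ∀ x p → gammaCorr (x + p * 6) ≡ gammaCorr x
gammaCorr-+*6 x p = cong-% (x + p * 6) x ([m+kn]%n≡m%n x p 6)
  where
  cong-% : ∀ m n → m % 6 ≡ n % 6 → gammaCorr m ≡ gammaCorr n
  cong-% m n m%6≡n%6 rewrite m%6≡n%6 = refl

construction-weight-≤ : ∀ s r p q → let m = toℕ s + suc p * 6 ; n = toℕ r + suc q * 3 in
  weight (Cycle m □ Cycle n) (tile (columns s) (layers r)) ≤ ceil/3 n * (m + gammaCorr m)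
construction-weight-≤ s r p q = begin
  weight (Cycle m □ Cycle n) (tile (columns s) (layers r))
    ≤⟨ tile-weight-≤ m n (columns s) (layers r) K (layers-weight-≤ r q) ⟩
  K * sum (applyUpTo (∥_∥ ∘ columns s) m)
    ≤⟨ *-monoʳ-≤ K (columns-weight-≤ s p) ⟩
  K * (m + gammaCorr (toℕ s))
    ≡⟨ cong₂ _*_ (ceil/3-+*3 (toℕ r) (suc q)) (cong (m +_) (gammaCorr-+*6 (toℕ s) (suc p))) ⟨
  ceil/3 n * (m + gammaCorr m) ∎
  where
  open ≤-Reasoning
  m = toℕ s + suc p * 6
  n = toℕ r + suc q * 3
  K = ceil/3 (toℕ r) + suc q

≥-divMod : ∀ k .{{_ : NonZero k}} {m} → k ≤ m → ∃[ s ] ∃[ p ] m ≡ toℕ {k} s + suc p * k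
≥-divMod k {m} k≤m with m / k | m≡m%n+[m/n]*n m k | m≥n⇒m/n>0 {m} {k} k≤m
... | suc p | m≡ | _ = m mod k , p , trans m≡ (cong (_+ suc p * k) (sym (toℕ-fromℕ< (m%n<n m k))))

proposition7 : (m n : ℕ) → 6 ≤ m → 3 ≤ n →
    γr2≤ (Cycle m □ Cycle n) (ceil/3 n * (m + gammaCorr m))
proposition7 m n 6≤m 3≤n with ≥-divMod 6 6≤m | ≥-divMod 3 3≤n
... | s , p , refl | r , q , refl =
  tile (columns s) (layers r) , construction-2RDF s r p q , construction-weight-≤ s r p q
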